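{- Let $m\ge 1$ and let $P_m\subseteq\mathbb{R}^{2m}$ be the polytope defined below. Every vertex of $P_m$ which is connected with $0$ by an edge of $P_m$ has at most $3$ non-zero coordinates; more precisely, such a vertex is one of the following: (i) $v(j_1,j_2)$ for $1\le j_1,j_2\le m$, $j_1\neq j_2$, the point with $v(j_1,j_2)_1^{j_1}=1$, $v(j_1,j_2)_2^{j_2}=1$ and all other coordinates $0$; (ii) $v(i;j_1,j_2,j_3)$ for $1\le j_1<j_2<j_3\le m$ and $i\in\{1,2\}$, the point with $v(i;j_1,j_2,j_3)_i^{j_1}=v(i;j_1,j_2,j_3)_i^{j_2}=v(i;j_1,j_2,j_3)_i^{j_3}=1$ and all other coordinates $0$.
   Context: Coordinates of $\mathbb{R}^{2m}$ are indexed $x_i^j$ with $i\in\{1,2\}$ (non-zero elements of $\mathbb{Z}_3$) and $1\le j\le m$. For $g_1,\dots,g_m\in\mathbb{Z}_3$ let $y(g_1,\dots,g_m)\in\mathbb{R}^{2m}$ have $y_i^j=1$ if $g_j=i$ and $0$ otherwise. $P_m=\operatorname{conv}\{y(g_1,\dots,g_m): g_1+\dots+g_m=0\in\mathbb{Z}_3\}$; it is the projection, onto the coordinates of non-zero group elements, of the polytope of the group-based model for the $m$-claw tree and the group $\mathbb{Z}_3$. Its vertices are exactly the points $y(g_1,\dots,g_m)$ with $\sum g_j=0$.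
   Formalization: An edge of $P_m$ joining a vertex to 0 is taken as one exposed by a linear functional with rational coefficients, with $P_m$ placed in ℚ^(2m) rather than $\mathbb{R}^{2m}$. -}

module Defs where

open import Data.Nat as ℕ using (ℕ; zero; suc; _%_)
open import Data.Fin as Fin using (Fin; zero; suc; toℕ)
open import Data.Fin.Properties using (_≟_)
open import Data.Rational using (ℚ; 0ℚ; 1ℚ; _+_; _*_)
open import Data.Product using (_×_)
open import Relation.Nullary using (Dec; yes; no; ¬_)
open import Relation.Nullary.Decidable using (_×-dec_; _⊎-dec_)
open import Relation.Binary.PropositionalEquality using (_≡_)

-- ℤ₃ is modelled by Fin 3 (elements 0,1,2).
-- A point of ℝ^{2m} (here with rational coordinates) is a function
-- Fin 2 → Fin m → ℚ ; coordinate index i : Fin 2 stands for the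
-- non-zero group element (toℕ i + 1) ∈ {1,2}, and j : Fin m for j+1.
Point : ℕ → Set
Point m = Fin 2 → Fin m → ℚ

gsum : ∀ {m} → (Fin m → Fin 3) → ℕ
gsum {zero} g = 0
gsum {suc m} g = toℕ (g zero) ℕ.+ gsum (λ j → g (suc j))

SumZero : ∀ {m} → (Fin m → Fin 3) → Set
SumZero g = gsum g % 3 ≡ 0

y : ∀ {m} → (Fin m → Fin 3) → Point m
y g i j with g j ≟ suc i
... | yes _ = 1ℚ
... | no _  = 0ℚ

sumFin : ∀ n → (Fin n → ℚ) → ℚ
sumFin zero f = 0ℚ
sumFin (suc n) f = f zero + sumFin n (λ j → f (suc j))

pairing : ∀ {m} → Point m → Point m → ℚ
pairing {m} c x = sumFin 2 (λ i → sumFin m (λ j → c i j * x i j))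

zeroAssign : ∀ {m} → Fin m → Fin 3
zeroAssign _ = zero

-- g and h are different assignments (equivalently y g ≠ y h)
Different : ∀ {m} → (Fin m → Fin 3) → (Fin m → Fin 3) → Set
Different g h = ¬ (∀ j → g j ≡ h j)

-- The vertex y(g) of P_m (g with SumZero g) is joined to the vertex 0 by
-- an edge of P_m: y(g) ≠ 0 and conv{0, y(g)} is a face of P_m, i.e. there
-- is a linear functional c maximised on P_m exactly at the vertices 0 and
-- y(g): ⟨c,0⟩ = ⟨c,y(g)⟩ = 0 and ⟨c,w⟩ < 0 for every other vertex w.
EdgeToZero : ∀ m → (Fin m → Fin 3) → Set
EdgeToZero m g =
  SumZero g × Different g zeroAssign ×
  Σ (Point m) (λ c →
    (pairing c (y g) ≡ 0ℚ) ×
    ((h : Fin m → Fin 3) → SumZero h → Different h zeroAssign → Different h g →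
       pairing c (y h) Data.Rational.< 0ℚ))
  where open import Data.Product using (Σ)
        import Data.Rational

ind : ∀ {P : Set} → Dec P → ℚ
ind (yes _) = 1ℚ
ind (no _)  = 0ℚ

i1 i2 : Fin 2
i1 = zero
i2 = suc zero

v₂ : ∀ {m} → Fin m → Fin m → Point m
v₂ j₁ j₂ i j = ind (((i ≟ i1) ×-dec (j ≟ j₁)) ⊎-dec ((i ≟ i2) ×-dec (j ≟ j₂)))

v₃ : ∀ {m} → Fin 2 → Fin m → Fin m → Fin m → Point m
v₃ i₀ j₁ j₂ j₃ i j = ind ((i ≟ i₀) ×-dec ((j ≟ j₁) ⊎-dec ((j ≟ j₂) ⊎-dec (j ≟ j₃))))

{-# OPTIONS --safe #-}

-- Let c be a functional exposing the edge [0, y(g)]: ⟨c, y(g)⟩ = 0 and ⟨c, y(h)⟩ < 0 for every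
-- other non-zero vertex y(h).  Restricting g to a set S of positions and to its complement
-- splits y(g) = y(g|S) + y(g|∁S), and if g|S is a non-zero zero-sum assignment while g does not
-- vanish outside S, both summands are such vertices and ⟨c, y(g)⟩ < 0.  So g vanishes outside
-- every S on which its restriction is non-zero and zero-sum.  If g takes both values 1 and 2,
-- at a and b, take S = {a, b}.  Otherwise all non-zero entries of g equal one k ≠ 0; as k and
-- 2k are non-zero in ℤ₃, g has at least three of them, and S can be any three.

module Submission where

open import Defs
open import Data.Nat using (ℕ; _≥_)
open import Data.Fin using (Fin; _<_)
open import Data.Product using (Σ; _×_)
open import Data.Sum using (_⊎_)
open import Relation.Nullary using (¬_)
open import Relation.Binary.PropositionalEquality using (_≡_)

import Algebra.Properties.CommutativeMonoid.Sum as CommutativeMonoidSum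
open import Data.Bool as Bool using (Bool; true; false; not; _∨_; if_then_else_)
open import Data.Bool.Properties using (∨-conicalˡ; ∨-conicalʳ)
open import Data.Empty using (⊥; ⊥-elim)
open import Data.Fin using (zero; suc; toℕ)
open import Data.Fin.Properties using (_≟_; any?; ¬∀⟶∃¬; <-cmp; <-trans; <⇒≢; 0≢1+n)
open import Data.Nat using (zero; suc; _+_; _%_)
open import Data.Nat.Divisibility using (_∣_; ∣m+n∣m⇒∣n; m%n≡0⇒n∣m; n∣m⇒m%n≡0)
import Data.Nat.Properties as ℕₚ
open import Data.Product using (∃; _,_)
open import Data.Rational as ℚ using (ℚ; 0ℚ)
import Data.Rational.Properties as ℚₚ
open import Data.Sum using (inj₁; inj₂; [_,_]; [_,_]′)
open import Function using (_∘_; id)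
open import Relation.Binary using (tri<; tri≈; tri>)
open import Relation.Binary.PropositionalEquality
  using (refl; sym; trans; cong; cong₂; subst; _≢_; module ≡-Reasoning)
open import Relation.Nullary using (Dec; yes; no; does)
open import Relation.Nullary.Decidable using (dec-true; dec-false; decidable-stable; ¬?; _×-dec_)

module ℕΣ = CommutativeMonoidSum ℕₚ.+-0-commutativeMonoid
module ℚΣ = CommutativeMonoidSum ℚₚ.+-0-commutativeMonoid

private
  variable
    m : ℕ
    g h h′ : Fin m → Fin 3
    S : Fin m → Bool
    a b c j : Fin m

one two : Fin 3
one = suc zero
two = suc (suc zero)

gsum≡∑ : (g : Fin m → Fin 3) → gsum g ≡ ℕΣ.sum (toℕ ∘ g)
gsum≡∑ {zero} g = refl
gsum≡∑ {suc m} g = cong (toℕ (g zero) +_) (gsum≡∑ (g ∘ suc))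

gsum-+ : (∀ j → toℕ (g j) ≡ toℕ (h j) + toℕ (h′ j)) → gsum g ≡ gsum h + gsum h′
gsum-+ {g = g} {h} {h′} split = begin
  gsum g                                 ≡⟨ gsum≡∑ g ⟩
  ℕΣ.sum (toℕ ∘ g)                       ≡⟨ ℕΣ.sum-cong-≗ split ⟩
  ℕΣ.sum (λ j → toℕ (h j) + toℕ (h′ j))  ≡⟨ ℕΣ.∑-distrib-+ (toℕ ∘ h) (toℕ ∘ h′) ⟩
  ℕΣ.sum (toℕ ∘ h) + ℕΣ.sum (toℕ ∘ h′)   ≡⟨ sym (cong₂ _+_ (gsum≡∑ h) (gsum≡∑ h′)) ⟩
  gsum h + gsum h′                       ∎
  where open ≡-Reasoning

gsum-cong : (∀ j → g j ≡ h j) → gsum g ≡ gsum h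
gsum-cong {g = g} {h} g≗h = begin
  gsum g            ≡⟨ gsum≡∑ g ⟩
  ℕΣ.sum (toℕ ∘ g)  ≡⟨ ℕΣ.sum-cong-≗ (cong toℕ ∘ g≗h) ⟩
  ℕΣ.sum (toℕ ∘ h)  ≡⟨ sym (gsum≡∑ h) ⟩
  gsum h            ∎
  where open ≡-Reasoning

gsum-zeroAssign : ∀ m → gsum {m} zeroAssign ≡ 0
gsum-zeroAssign zero = refl
gsum-zeroAssign (suc m) = gsum-zeroAssign m

sumFin≡∑ : ∀ n (f : Fin n → ℚ) → sumFin n f ≡ ℚΣ.sum f
sumFin≡∑ zero f = refl
sumFin≡∑ (suc n) f = cong (f zero ℚ.+_) (sumFin≡∑ n (f ∘ suc))

sumFin-cong : ∀ n {f f′ : Fin n → ℚ} → (∀ j → f j ≡ f′ j) → sumFin n f ≡ sumFin n f′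
sumFin-cong n {f} {f′} f≗f′ = begin
  sumFin n f   ≡⟨ sumFin≡∑ n f ⟩
  ℚΣ.sum f     ≡⟨ ℚΣ.sum-cong-≗ f≗f′ ⟩
  ℚΣ.sum f′    ≡⟨ sym (sumFin≡∑ n f′) ⟩
  sumFin n f′  ∎
  where open ≡-Reasoning

sumFin-+ : ∀ n (f f′ : Fin n → ℚ) → sumFin n (λ j → f j ℚ.+ f′ j) ≡ sumFin n f ℚ.+ sumFin n f′
sumFin-+ n f f′ = begin
  sumFin n (λ j → f j ℚ.+ f′ j)  ≡⟨ sumFin≡∑ n _ ⟩
  ℚΣ.sum (λ j → f j ℚ.+ f′ j)    ≡⟨ ℚΣ.∑-distrib-+ f f′ ⟩
  ℚΣ.sum f ℚ.+ ℚΣ.sum f′         ≡⟨ sym (cong₂ ℚ._+_ (sumFin≡∑ n f) (sumFin≡∑ n f′)) ⟩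
  sumFin n f ℚ.+ sumFin n f′     ∎
  where open ≡-Reasoning

pairing-+ : (c x x′ x″ : Point m) → (∀ i j → x i j ≡ x′ i j ℚ.+ x″ i j) →
            pairing c x ≡ pairing c x′ ℚ.+ pairing c x″
pairing-+ {m} c x x′ x″ split = begin
  pairing c x
    ≡⟨ sumFin-cong 2 (λ i → sumFin-cong m (λ j → distrib i j)) ⟩
  sumFin 2 (λ i → sumFin m (λ j → c i j ℚ.* x′ i j ℚ.+ c i j ℚ.* x″ i j))
    ≡⟨ sumFin-cong 2 (λ i → sumFin-+ m (λ j → c i j ℚ.* x′ i j) (λ j → c i j ℚ.* x″ i j)) ⟩
  sumFin 2 (λ i → sumFin m (λ j → c i j ℚ.* x′ i j) ℚ.+ sumFin m (λ j → c i j ℚ.* x″ i j))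
    ≡⟨ sumFin-+ 2 (λ i → sumFin m (λ j → c i j ℚ.* x′ i j))
                  (λ i → sumFin m (λ j → c i j ℚ.* x″ i j)) ⟩
  pairing c x′ ℚ.+ pairing c x″
    ∎
  where
  open ≡-Reasoning
  distrib : ∀ i j → c i j ℚ.* x i j ≡ c i j ℚ.* x′ i j ℚ.+ c i j ℚ.* x″ i j
  distrib i j = trans (cong (c i j ℚ.*_) (split i j)) (ℚₚ.*-distribˡ-+ (c i j) (x′ i j) (x″ i j))

⁅_⁆ : Fin m → Fin m → Bool
⁅ a ⁆ j = does (j ≟ a)

infixr 6 _∪_

_∪_ : (Fin m → Bool) → (Fin m → Bool) → Fin m → Bool
(S ∪ T) j = S j ∨ T j

∁ : (Fin m → Bool) → Fin m → Bool
∁ S j = not (S j)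

∉⁅⁆ : j ≢ a → ⁅ a ⁆ j ≡ false
∉⁅⁆ {j = j} {a} = dec-false (j ≟ a)

∉⁅⁆⇒≢ : ⁅ a ⁆ j ≡ false → j ≢ a
∉⁅⁆⇒≢ {a = a} j∉a refl with () ← trans (sym (dec-true (a ≟ a) refl)) j∉a

different-at : ∀ j → g j ≢ h j → Different g h
different-at j gj≢hj g≗h = gj≢hj (g≗h j)

nonzero-somewhere : Different g zeroAssign → ∃ λ j → g j ≢ zero
nonzero-somewhere {m} {g} = ¬∀⟶∃¬ m _ (λ j → g j ≟ zero)

restrict : (Fin m → Bool) → (Fin m → Fin 3) → Fin m → Fin 3
restrict S g j = if S j then g j else zero

VanishesOutside : (Fin m → Bool) → (Fin m → Fin 3) → Set
VanishesOutside S g = ∀ j → S j ≡ false → g j ≡ zero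

vanishesOutside? : ∀ S (g : Fin m → Fin 3) → VanishesOutside S g ⊎ ∃ λ j → S j ≡ false × g j ≢ zero
vanishesOutside? S g with any? (λ j → (S j Bool.≟ false) ×-dec ¬? (g j ≟ zero))
... | yes witness = inj₂ witness
... | no none = inj₁ λ j j∉S → decidable-stable (g j ≟ zero) (λ gj≢0 → none (j , j∉S , gj≢0))

restrict-∉ : ∀ S (g : Fin m → Fin 3) → S j ≡ false → restrict S g j ≡ zero
restrict-∉ S g j∉S rewrite j∉S = refl

restrict-∁-∉ : ∀ S (g : Fin m → Fin 3) → S j ≡ false → restrict (∁ S) g j ≡ g j
restrict-∁-∉ S g j∉S rewrite j∉S = refl

restrict-⁅⁆∪ : ∀ a S (g : Fin m → Fin 3) → restrict (⁅ a ⁆ ∪ S) g a ≡ g a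
restrict-⁅⁆∪ a S g rewrite dec-true (a ≟ a) refl = refl

restrict-vanishesOutside : VanishesOutside S g → ∀ j → restrict S g j ≡ g j
restrict-vanishesOutside {S = S} vanishes j with S j in Sj
... | true = refl
... | false = sym (vanishes j Sj)

restrict-∁-fixed⇒restrict-zero : (∀ j → restrict (∁ S) g j ≡ g j) → ∀ j → restrict S g j ≡ zero
restrict-∁-fixed⇒restrict-zero {S = S} fixed j with S j | fixed j
... | true | zero≡gj = sym zero≡gj
... | false | _ = refl

gsum-restrict-∁ : ∀ S (g : Fin m → Fin 3) → gsum g ≡ gsum (restrict S g) + gsum (restrict (∁ S) g)
gsum-restrict-∁ S g = gsum-+ split
  where
  split : ∀ j → toℕ (g j) ≡ toℕ (restrict S g j) + toℕ (restrict (∁ S) g j)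
  split j with S j
  ... | true = sym (ℕₚ.+-identityʳ _)
  ... | false = refl

gsum-restrict-⁅⁆ : ∀ (a : Fin m) g → gsum (restrict ⁅ a ⁆ g) ≡ toℕ (g a)
gsum-restrict-⁅⁆ {suc m} zero g = trans (cong (toℕ (g zero) +_) (gsum-zeroAssign m)) (ℕₚ.+-identityʳ _)
gsum-restrict-⁅⁆ {suc m} (suc a) g = gsum-restrict-⁅⁆ a (g ∘ suc)

gsum-restrict-⁅⁆∪ : S a ≡ false → gsum (restrict (⁅ a ⁆ ∪ S) g) ≡ toℕ (g a) + gsum (restrict S g)
gsum-restrict-⁅⁆∪ {S = S} {a} {g = g} a∉S =
  trans (gsum-+ split) (cong (_+ gsum (restrict S g)) (gsum-restrict-⁅⁆ a g))
  where
  split : ∀ j → toℕ (restrict (⁅ a ⁆ ∪ S) g j) ≡ toℕ (restrict ⁅ a ⁆ g j) + toℕ (restrict S g j)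
  split j with j ≟ a
  ... | yes refl rewrite a∉S = sym (ℕₚ.+-identityʳ _)
  ... | no _ = refl

restrict-⁅⁆∪-nonzero : g a ≢ zero → Different (restrict (⁅ a ⁆ ∪ S) g) zeroAssign
restrict-⁅⁆∪-nonzero {g = g} {a} {S} ga≢0 = different-at a (ga≢0 ∘ trans (sym (restrict-⁅⁆∪ a S g)))

gsum-restrict-⁅⁆∪⁅⁆ : a ≢ b → gsum (restrict (⁅ a ⁆ ∪ ⁅ b ⁆) g) ≡ toℕ (g a) + toℕ (g b)
gsum-restrict-⁅⁆∪⁅⁆ {a = a} {b} {g} a≢b =
  trans (gsum-restrict-⁅⁆∪ {S = ⁅ b ⁆} {g = g} (∉⁅⁆ a≢b))
        (cong (toℕ (g a) +_) (gsum-restrict-⁅⁆ b g))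

gsum-restrict-⁅⁆∪⁅⁆∪⁅⁆ : a ≢ b → a ≢ c → b ≢ c →
  gsum (restrict (⁅ a ⁆ ∪ ⁅ b ⁆ ∪ ⁅ c ⁆) g) ≡ toℕ (g a) + (toℕ (g b) + toℕ (g c))
gsum-restrict-⁅⁆∪⁅⁆∪⁅⁆ {a = a} {b} {c} {g} a≢b a≢c b≢c =
  trans (gsum-restrict-⁅⁆∪ {S = ⁅ b ⁆ ∪ ⁅ c ⁆} {g = g} (cong₂ _∨_ (∉⁅⁆ a≢b) (∉⁅⁆ a≢c)))
        (cong (toℕ (g a) +_) (gsum-restrict-⁅⁆∪⁅⁆ {g = g} b≢c))

SumZero-restrict-∁ : ∀ S → SumZero g → SumZero (restrict S g) → SumZero (restrict (∁ S) g)
SumZero-restrict-∁ {g = g} S g₀ h₀ =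
  n∣m⇒m%n≡0 (gsum (restrict (∁ S) g)) 3
    (∣m+n∣m⇒∣n 3∣sum (m%n≡0⇒n∣m (gsum (restrict S g)) 3 h₀))
  where
  3∣sum : 3 ∣ gsum (restrict S g) + gsum (restrict (∁ S) g)
  3∣sum = m%n≡0⇒n∣m _ 3 (subst (λ n → n % 3 ≡ 0) (gsum-restrict-∁ S g) g₀)

nonzero-outside : SumZero g → ¬ SumZero (restrict S g) → ∃ λ j → S j ≡ false × g j ≢ zero
nonzero-outside {g = g} {S = S} g₀ ¬h₀ with vanishesOutside? S g
... | inj₂ witness = witness
... | inj₁ vanishes = ⊥-elim (¬h₀ (subst (λ n → n % 3 ≡ 0) g≡h g₀))
  where
  g≡h : gsum g ≡ gsum (restrict S g)
  g≡h = sym (gsum-cong (restrict-vanishesOutside vanishes))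

y-at : ∀ {x} (g : Fin m → Fin 3) i j → g j ≡ x → y g i j ≡ ind (x ≟ suc i)
y-at g i j refl with g j ≟ suc i
... | yes _ = refl
... | no _ = refl

y-restrict-∁ : ∀ S (g : Fin m → Fin 3) i j → y g i j ≡ y (restrict S g) i j ℚ.+ y (restrict (∁ S) g) i j
y-restrict-∁ S g i j = begin
  y g i j
    ≡⟨ y-at g i j refl ⟩
  ind (g j ≟ suc i)
    ≡⟨ split (S j) ⟩
  ind (restrict S g j ≟ suc i) ℚ.+ ind (restrict (∁ S) g j ≟ suc i)
    ≡⟨ sym (cong₂ ℚ._+_ (y-at (restrict S g) i j refl) (y-at (restrict (∁ S) g) i j refl)) ⟩
  y (restrict S g) i j ℚ.+ y (restrict (∁ S) g) i j
    ∎
  where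
  open ≡-Reasoning
  split : ∀ b → ind (g j ≟ suc i) ≡
                ind ((if b then g j else zero) ≟ suc i) ℚ.+ ind ((if not b then g j else zero) ≟ suc i)
  split true = sym (ℚₚ.+-identityʳ _)
  split false = sym (ℚₚ.+-identityˡ _)

edge-indecomposable : EdgeToZero m g → (∀ i j → y g i j ≡ y h i j ℚ.+ y h′ i j) →
  SumZero h → SumZero h′ → Different h zeroAssign → Different h′ zeroAssign →
  Different h g → Different h′ g → ⊥
edge-indecomposable {g = g} {h} {h′} (_ , _ , c , c·y≡0 , c·y<0) split h₀ h′₀ h≢0 h′≢0 h≢g h′≢g =
  ℚₚ.<-irrefl refl (begin-strict
    0ℚ                                    ≡⟨ sym c·y≡0 ⟩
    pairing c (y g)                       ≡⟨ pairing-+ c (y g) (y h) (y h′) split ⟩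
    pairing c (y h) ℚ.+ pairing c (y h′)  <⟨ ℚₚ.+-mono-< (c·y<0 h h₀ h≢0 h≢g) (c·y<0 h′ h′₀ h′≢0 h′≢g) ⟩
    0ℚ ℚ.+ 0ℚ                             ≡⟨ ℚₚ.+-identityʳ 0ℚ ⟩
    0ℚ                                    ∎)
  where open ℚₚ.≤-Reasoning

edge-vanishesOutside : EdgeToZero m g → SumZero (restrict S g) → Different (restrict S g) zeroAssign →
                       VanishesOutside S g
edge-vanishesOutside {g = g} {S = S} edge@(g₀ , _) h₀ h≢0 with vanishesOutside? S g
... | inj₁ vanishes = vanishes
... | inj₂ (j , j∉S , gj≢0) =
  ⊥-elim (edge-indecomposable edge (y-restrict-∁ S g) h₀ (SumZero-restrict-∁ S g₀ h₀)
                               h≢0 h′≢0 h≢g h′≢g)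
  where
  h′≢0 : Different (restrict (∁ S) g) zeroAssign
  h′≢0 = different-at j (λ h′j≡0 → gj≢0 (trans (sym (restrict-∁-∉ S g j∉S)) h′j≡0))
  h≢g : Different (restrict S g) g
  h≢g = different-at j (λ hj≡gj → gj≢0 (trans (sym hj≡gj) (restrict-∉ S g j∉S)))
  h′≢g : Different (restrict (∁ S) g) g
  h′≢g h′≗g = h≢0 (restrict-∁-fixed⇒restrict-zero h′≗g)

x%3≢0 : ∀ {x : Fin 3} → x ≢ zero → toℕ x % 3 ≢ 0
x%3≢0 {zero} x≢0 = ⊥-elim (x≢0 refl)
x%3≢0 {suc zero} _ ()
x%3≢0 {suc (suc zero)} _ ()

2x%3≢0 : ∀ {x : Fin 3} → x ≢ zero → (toℕ x + toℕ x) % 3 ≢ 0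
2x%3≢0 {zero} x≢0 = ⊥-elim (x≢0 refl)
2x%3≢0 {suc zero} _ ()
2x%3≢0 {suc (suc zero)} _ ()

3x%3≡0 : ∀ (x : Fin 3) → (toℕ x + (toℕ x + toℕ x)) % 3 ≡ 0
3x%3≡0 zero = refl
3x%3≡0 (suc zero) = refl
3x%3≡0 (suc (suc zero)) = refl

three-nonzero-positions : ∀ k → SumZero g → Different g zeroAssign → (∀ j → g j ≢ zero → g j ≡ suc k) →
  ∃ λ a → ∃ λ b → ∃ λ c → a ≢ b × a ≢ c × b ≢ c × g a ≡ suc k × g b ≡ suc k × g c ≡ suc k
three-nonzero-positions {g = g} k g₀ g≢0 value with nonzero-somewhere g≢0
... | a , ga≢0 with nonzero-outside {S = ⁅ a ⁆} g₀
      (x%3≢0 ga≢0 ∘ subst (λ n → n % 3 ≡ 0) (gsum-restrict-⁅⁆ a g))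
... | b , b∉a , gb≢0 with nonzero-outside {S = ⁅ a ⁆ ∪ ⁅ b ⁆} g₀
      (2x%3≢0 {suc k} (λ ()) ∘ subst (λ n → n % 3 ≡ 0)
        (trans (gsum-restrict-⁅⁆∪⁅⁆ {g = g} (∉⁅⁆⇒≢ b∉a ∘ sym))
               (cong₂ _+_ (cong toℕ (value a ga≢0)) (cong toℕ (value b gb≢0)))))
... | c , c∉ab , gc≢0 =
  a , b , c , ∉⁅⁆⇒≢ b∉a ∘ sym , ∉⁅⁆⇒≢ (∨-conicalˡ _ _ c∉ab) ∘ sym , ∉⁅⁆⇒≢ (∨-conicalʳ _ _ c∉ab) ∘ sym ,
  value a ga≢0 , value b gb≢0 , value c gc≢0

sort-distinct : (P : Fin m → Fin m → Fin m → Set) →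
  (∀ {a b c} → P a b c → P b a c) → (∀ {a b c} → P a b c → P a c b) →
  a ≢ b → a ≢ c → b ≢ c → P a b c → ∃ λ a′ → ∃ λ b′ → ∃ λ c′ → a′ < b′ × b′ < c′ × P a′ b′ c′
sort-distinct {a = a} {b} {c} P swap₁₂ swap₂₃ a≢b a≢c b≢c p with <-cmp a b | <-cmp b c | <-cmp a c
... | tri≈ _ a≡b _ | _ | _ = ⊥-elim (a≢b a≡b)
... | _ | tri≈ _ b≡c _ | _ = ⊥-elim (b≢c b≡c)
... | _ | _ | tri≈ _ a≡c _ = ⊥-elim (a≢c a≡c)
... | tri< a<b _ _ | tri< b<c _ _ | _ = a , b , c , a<b , b<c , p
... | tri< _ _ _ | tri> _ _ c<b | tri< a<c _ _ = a , c , b , a<c , c<b , swap₂₃ p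
... | tri< a<b _ _ | tri> _ _ _ | tri> _ _ c<a = c , a , b , c<a , a<b , swap₁₂ (swap₂₃ p)
... | tri> _ _ b<a | tri< _ _ _ | tri< a<c _ _ = b , a , c , b<a , a<c , swap₁₂ p
... | tri> _ _ _ | tri< b<c _ _ | tri> _ _ c<a = b , c , a , b<c , c<a , swap₂₃ (swap₁₂ p)
... | tri> _ _ b<a | tri> _ _ c<b | _ = c , b , a , c<b , b<a , swap₂₃ (swap₁₂ (swap₂₃ p))

y≡v₂ : a ≢ b → g a ≡ one → g b ≡ two → (∀ j → j ≢ a → j ≢ b → g j ≡ zero) →
       ∀ i j → y g i j ≡ v₂ a b i j
y≡v₂ {a = a} {b} {g} a≢b ga gb outside i j with j ≟ a | j ≟ b | i
... | yes refl | yes refl | _ = ⊥-elim (a≢b refl)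
... | yes refl | no _ | zero = y-at g zero j ga
... | yes refl | no _ | suc zero = y-at g (suc zero) j ga
... | no _ | yes refl | zero = y-at g zero j gb
... | no _ | yes refl | suc zero = y-at g (suc zero) j gb
... | no j≢a | no j≢b | zero = y-at g zero j (outside j j≢a j≢b)
... | no j≢a | no j≢b | suc zero = y-at g (suc zero) j (outside j j≢a j≢b)

ind-suc≟suc : ∀ (k i : Fin 2) {P : Set} (d : Dec P) → P → ind (suc k ≟ suc i) ≡ ind ((i ≟ k) ×-dec d)
ind-suc≟suc k i (no ¬p) p = ⊥-elim (¬p p)
ind-suc≟suc zero zero (yes _) _ = refl
ind-suc≟suc zero (suc zero) (yes _) _ = refl
ind-suc≟suc (suc zero) zero (yes _) _ = refl
ind-suc≟suc (suc zero) (suc zero) (yes _) _ = refl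

ind-zero≟suc : ∀ (k i : Fin 2) {P : Set} (d : Dec P) → ¬ P → ind (zero ≟ suc i) ≡ ind ((i ≟ k) ×-dec d)
ind-zero≟suc k i (yes p) ¬p = ⊥-elim (¬p p)
ind-zero≟suc zero zero (no _) _ = refl
ind-zero≟suc zero (suc zero) (no _) _ = refl
ind-zero≟suc (suc zero) zero (no _) _ = refl
ind-zero≟suc (suc zero) (suc zero) (no _) _ = refl

y≡v₃ : ∀ k → g a ≡ suc k → g b ≡ suc k → g c ≡ suc k → (∀ j → j ≢ a → j ≢ b → j ≢ c → g j ≡ zero) →
       ∀ i j → y g i j ≡ v₃ k a b c i j
y≡v₃ {g = g} {a} {b} {c} k ga gb gc outside i j with j ≟ a | j ≟ b | j ≟ c
... | yes refl | _ | _ = trans (y-at g i j ga) (ind-suc≟suc k i _ (inj₁ refl))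
... | no _ | yes refl | _ = trans (y-at g i j gb) (ind-suc≟suc k i _ (inj₂ (inj₁ refl)))
... | no _ | no _ | yes refl = trans (y-at g i j gc) (ind-suc≟suc k i _ (inj₂ (inj₂ refl)))
... | no j≢a | no j≢b | no j≢c =
  trans (y-at g i j (outside j j≢a j≢b j≢c)) (ind-zero≟suc k i _ [ j≢a , [ j≢b , j≢c ] ])

one-or-two : ∀ {x : Fin 3} → x ≢ zero → x ≡ one ⊎ x ≡ two
one-or-two {zero} x≢0 = ⊥-elim (x≢0 refl)
one-or-two {suc zero} _ = inj₁ refl
one-or-two {suc (suc zero)} _ = inj₂ refl

edge-both-values : EdgeToZero m g → g a ≡ one → g b ≡ two →
  Σ (Fin m) (λ j₁ → Σ (Fin m) (λ j₂ → ¬ (j₁ ≡ j₂) × (∀ i j → y g i j ≡ v₂ j₁ j₂ i j)))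
edge-both-values {g = g} {a} {b} edge ga gb = a , b , a≢b , y≡v₂ a≢b ga gb outside
  where
  a≢b : a ≢ b
  a≢b refl with () ← trans (sym ga) gb
  h₀ : SumZero (restrict (⁅ a ⁆ ∪ ⁅ b ⁆) g)
  h₀ = subst (λ n → n % 3 ≡ 0)
         (sym (trans (gsum-restrict-⁅⁆∪⁅⁆ a≢b) (cong₂ _+_ (cong toℕ ga) (cong toℕ gb))))
         refl
  outside : ∀ j → j ≢ a → j ≢ b → g j ≡ zero
  outside j j≢a j≢b =
    edge-vanishesOutside edge h₀ (restrict-⁅⁆∪-nonzero (λ ga≡0 → 0≢1+n (trans (sym ga≡0) ga))) j
      (cong₂ _∨_ (∉⁅⁆ j≢a) (∉⁅⁆ j≢b))

edge-single-value : ∀ k → EdgeToZero m g → (∀ j → g j ≢ zero → g j ≡ suc k) →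
  Σ (Fin m) (λ j₁ → Σ (Fin m) (λ j₂ → Σ (Fin m) (λ j₃ →
    j₁ < j₂ × j₂ < j₃ × (∀ i j → y g i j ≡ v₃ k j₁ j₂ j₃ i j))))
edge-single-value {g = g} k edge@(g₀ , g≢0 , _) value
  with a , b , c , a≢b , a≢c , b≢c , values ← three-nonzero-positions k g₀ g≢0 value
  with a , b , c , a<b , b<c , ga , gb , gc ←
         sort-distinct (λ a b c → g a ≡ suc k × g b ≡ suc k × g c ≡ suc k)
           (λ (ga , gb , gc) → gb , ga , gc) (λ (ga , gb , gc) → ga , gc , gb) a≢b a≢c b≢c values
  = a , b , c , a<b , b<c , y≡v₃ k ga gb gc outside
  where
  h₀ : SumZero (restrict (⁅ a ⁆ ∪ ⁅ b ⁆ ∪ ⁅ c ⁆) g)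
  h₀ = subst (λ n → n % 3 ≡ 0)
         (sym (trans (gsum-restrict-⁅⁆∪⁅⁆∪⁅⁆ (<⇒≢ a<b) (<⇒≢ (<-trans a<b b<c)) (<⇒≢ b<c))
                     (cong₂ _+_ (cong toℕ ga) (cong₂ _+_ (cong toℕ gb) (cong toℕ gc)))))
         (3x%3≡0 (suc k))
  outside : ∀ j → j ≢ a → j ≢ b → j ≢ c → g j ≡ zero
  outside j j≢a j≢b j≢c =
    edge-vanishesOutside edge h₀ (restrict-⁅⁆∪-nonzero (λ ga≡0 → 0≢1+n (trans (sym ga≡0) ga))) j
      (cong₂ _∨_ (∉⁅⁆ j≢a) (cong₂ _∨_ (∉⁅⁆ j≢b) (∉⁅⁆ j≢c)))

lemma2p1 : (m : ℕ) → m ≥ 1 → (g : Fin m → Fin 3) → EdgeToZero m g →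
    Σ (Fin m) (λ j₁ → Σ (Fin m) (λ j₂ → ¬ (j₁ ≡ j₂) × (∀ i j → y g i j ≡ v₂ j₁ j₂ i j)))
    ⊎ Σ (Fin 2) (λ i₀ → Σ (Fin m) (λ j₁ → Σ (Fin m) (λ j₂ → Σ (Fin m) (λ j₃ →
        j₁ < j₂ × j₂ < j₃ × (∀ i j → y g i j ≡ v₃ i₀ j₁ j₂ j₃ i j)))))
lemma2p1 m _ g edge with any? (λ j → g j ≟ one) | any? (λ j → g j ≟ two)
... | yes (a , ga) | yes (b , gb) = inj₁ (edge-both-values edge ga gb)
... | no no-one | _ = inj₂ (suc zero , edge-single-value (suc zero) edge only-two)
  where
  only-two : ∀ j → g j ≢ zero → g j ≡ two
  only-two j gj≢0 = [ (λ gj≡1 → ⊥-elim (no-one (j , gj≡1))) , id ]′ (one-or-two gj≢0)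
... | yes _ | no no-two = inj₂ (zero , edge-single-value zero edge only-one)
  where
  only-one : ∀ j → g j ≢ zero → g j ≡ one
  only-one j gj≢0 = [ id , (λ gj≡2 → ⊥-elim (no-two (j , gj≡2))) ]′ (one-or-two gj≢0)
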